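{- Let $G=(V,E)$ be a graph, let $\{C_1,C_2\}$ be a $2$-community structure of $G$, and let $v\in V$ with $d(v)\ge 1$. If $N_{C_i}(v)=\emptyset$ for some $i\in\{1,2\}$, then $v\in C_{3-i}$.
   Context: $d(v)$ is the degree of $v$ and $N_C(v)$ the set of neighbours of $v$ in $C$. A $2$-community structure of $G=(V,E)$ is a partition $\{C_1,C_2\}$ of $V$ with $|C_1|,|C_2|\ge 2$ such that for $i\in\{1,2\}$ and every $v\in C_i$: $\frac{|N_{C_i}(v)|}{|C_i|-1}\ge\frac{|N_{C_{3-i}}(v)|}{|C_{3-i}|}$. -}

module Defs where

open import Data.Nat using (ℕ; _*_; _∸_; _≤_; _≥_)
open import Data.Bool using (Bool; true; false; not; _∧_; T)
open import Data.Fin using (Fin)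
open import Data.List using (List; length; filter)
open import Data.List.Base using (allFin)
open import Data.Bool.Properties using (T?)
open import Relation.Binary.PropositionalEquality using (_≡_)
open import Relation.Nullary using (¬_)
open import Data.Product using (_×_)

record Graph (n : ℕ) : Set where
  field
    adj   : Fin n → Fin n → Bool
    sym   : ∀ u v → adj u v ≡ adj v u
    irrefl : ∀ v → adj v v ≡ false
open Graph public

count : {n : ℕ} → (Fin n → Bool) → ℕ
count {n} p = length (filter (λ u → T? (p u)) (allFin n))

deg : {n : ℕ} → Graph n → Fin n → ℕ
deg G v = count (adj G v)

-- A bipartition {C₁, C₂} of V is encoded by  side : Fin n → Bool,
-- with C₁ = { v | side v ≡ true } and C₂ = { v | side v ≡ false }.
-- Part b is { v | side v ≡ b }.
inPart : {n : ℕ} → (Fin n → Bool) → Bool → Fin n → Bool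
inPart side true  u = side u
inPart side false u = not (side u)

partSize : {n : ℕ} → (Fin n → Bool) → Bool → ℕ
partSize side b = count (inPart side b)

nbrsIn : {n : ℕ} → Graph n → (Fin n → Bool) → Bool → Fin n → ℕ
nbrsIn G side b v = count (λ u → adj G v u ∧ inPart side b u)

-- 2-community structure: both parts have size ≥ 2, and for each part b and
-- each v ∈ C_b:  |N_{C_b}(v)| / (|C_b| - 1) ≥ |N_{C_{¬b}}(v)| / |C_{¬b}|,
-- stated by cross-multiplication (denominators are positive since |C_b| ≥ 2).
record Is2CommunityStructure {n : ℕ} (G : Graph n) (side : Fin n → Bool) : Set where
  field
    size-ok : ∀ b → partSize side b ≥ 2
    comm-ok : ∀ b (v : Fin n) → T (inPart side b v) →
      nbrsIn G side (not b) v * (partSize side b ∸ 1)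
        ≤ nbrsIn G side b v * partSize side (not b)

-- If v lay in C_i, the community inequality at v would read
-- |N_{C_{3-i}}(v)| (|C_i| - 1) ≤ 0 · |C_{3-i}|; since |C_i| ≥ 2 this forces
-- N_{C_{3-i}}(v) = ∅, so v would have no neighbours at all, contradicting d(v) ≥ 1.
module Submission where

open import Defs hiding (sym)
open import Data.Nat using (ℕ; _*_; _∸_; _≥_; _≤_; s≤s; NonZero)
open import Data.Nat.Properties using (n≤0⇒n≡0; m*n≡0⇒m≡0; n>0⇒n≢0)
open import Data.Bool using (Bool; true; false; not; T; _∧_)
open import Data.Bool.Properties using (T?)
open import Data.Fin using (Fin)
open import Data.List using (length)
open import Data.List.Base using (allFin)
open import Data.List.Properties using (filter-none)
open import Data.List.Relation.Unary.All using (tabulate)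
open import Data.List.Membership.Propositional.Properties
  using (∈-allFin; ∈-filter⁺; ∈-length)
open import Data.Unit using (tt)
open import Relation.Nullary using (contradiction)
open import Relation.Binary.PropositionalEquality
  using (_≡_; refl; sym; cong; subst)

module _ {n : ℕ} (p : Fin n → Bool) where

  count-pos : ∀ {u} → T (p u) → 1 ≤ count p
  count-pos {u} pu = ∈-length (∈-filter⁺ (λ v → T? (p v)) (∈-allFin u) pu)

  count≡0⇒none : count p ≡ 0 → ∀ u → p u ≡ false
  count≡0⇒none c≡0 u with p u in p-u
  ... | false = refl
  ... | true  = contradiction c≡0 (n>0⇒n≢0 (count-pos (subst T (sym p-u) tt)))

  none⇒count≡0 : (∀ u → p u ≡ false) → count p ≡ 0
  none⇒count≡0 none =
    cong length (filter-none (λ v → T? (p v)) {allFin n} (tabulate λ {u} _ pu → subst T (none u) pu))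

inPart-complement : ∀ {n} (side : Fin n → Bool) b u →
  inPart side b u ≡ false → T (inPart side (not b) u)
inPart-complement side true  u eq with side u
inPart-complement side true  u () | true
inPart-complement side true  u refl | false = tt
inPart-complement side false u eq with side u
inPart-complement side false u refl | true = tt

∧-inPart-cover : ∀ {n} (side : Fin n → Bool) b u a →
  (a ∧ inPart side b u) ≡ false → (a ∧ inPart side (not b) u) ≡ false → a ≡ false
∧-inPart-cover side b u false _ _ = refl
∧-inPart-cover side true  u true p q with side u
∧-inPart-cover side true  u true () q | true
∧-inPart-cover side true  u true p () | false
∧-inPart-cover side false u true p q with side u
∧-inPart-cover side false u true p () | true
∧-inPart-cover side false u true () q | false

nbrsIn≡0-both⇒deg≡0 : ∀ {n} (G : Graph n) side b v →
  nbrsIn G side b v ≡ 0 → nbrsIn G side (not b) v ≡ 0 → deg G v ≡ 0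
nbrsIn≡0-both⇒deg≡0 G side b v nb≡0 n¬b≡0 = none⇒count≡0 (adj G v) λ u →
  ∧-inPart-cover side b u (adj G v u)
    (count≡0⇒none _ nb≡0 u) (count≡0⇒none _ n¬b≡0 u)

pred-nonZero : ∀ {s} → s ≥ 2 → NonZero (s ∸ 1)
pred-nonZero (s≤s (s≤s _)) = _

module _ {n} {G : Graph n} {side : Fin n → Bool} (cs : Is2CommunityStructure G side) where
  open Is2CommunityStructure cs

  nbrsIn-own≡0⇒nbrsIn-other≡0 : ∀ b v → T (inPart side b v) →
    nbrsIn G side b v ≡ 0 → nbrsIn G side (not b) v ≡ 0
  nbrsIn-own≡0⇒nbrsIn-other≡0 b v v∈Cb own≡0 =
    m*n≡0⇒m≡0 _ _ {{pred-nonZero (size-ok b)}} (n≤0⇒n≡0 bound)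
    where
    bound : nbrsIn G side (not b) v * (partSize side b ∸ 1) ≤ 0
    bound = subst (λ k → nbrsIn G side (not b) v * (partSize side b ∸ 1) ≤ k * partSize side (not b))
                  own≡0 (comm-ok b v v∈Cb)

mainTheorem7 : {n : ℕ} (G : Graph n) (side : Fin n → Bool) →
    Is2CommunityStructure G side → (v : Fin n) → deg G v ≥ 1 →
    (i : Bool) → nbrsIn G side i v ≡ 0 → T (inPart side (not i) v)
mainTheorem7 G side cs v deg≥1 i Ni≡0 with inPart side i v in v∈Ci
... | false = inPart-complement side i v v∈Ci
... | true  = contradiction isolated (n>0⇒n≢0 deg≥1)
  where
  isolated : deg G v ≡ 0
  isolated = nbrsIn≡0-both⇒deg≡0 G side i v Ni≡0
    (nbrsIn-own≡0⇒nbrsIn-other≡0 cs i v (subst T (sym v∈Ci) tt) Ni≡0)
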